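{- Let $G$ be a finite simple graph that is vertex-critical for Property $(\star)$. Then there are no two distinct vertices $x,y$ of $G$ such that $x$ dominates $y$, i.e. such that $N(y)\subseteq N[x]$.
   Context: Property $(\star)$ for a graph $G$ means $\chi(G) > \Delta_2(G)+3$, where $\Delta_2(G)$ is the maximum, over distinct vertices $u,v$, of the number of common neighbors of $u$ and $v$. $G$ is vertex-critical for Property $(\star)$ if $G$ satisfies Property $(\star)$ but no proper induced subgraph of $G$ does. $N(y)$ is the open neighborhood of $y$ and $N[x]=N(x)\cup\{x\}$. -}

module Defs where

open import Data.Nat using (ℕ; _+_; _<_; _≤_; _⊔_)
open import Data.Fin using (Fin; _≟_)
open import Data.Bool using (Bool; true; false; _∧_; if_then_else_)
open import Data.List using (List; map; foldr; concatMap)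
open import Data.Nat.ListAction using (sum)
open import Data.List using () renaming (allFin to allFinL)
open import Data.Product using (Σ; ∃-syntax; _×_)
open import Data.Sum using (_⊎_)
open import Relation.Nullary using (¬_; yes; no)
open import Relation.Binary.PropositionalEquality using (_≡_; _≢_)
open import Function.Definitions using (Injective)

record Graph : Set where
  field
    n      : ℕ
    adj    : Fin n → Fin n → Bool
    sym    : ∀ u v → adj u v ≡ adj v u
    irrefl : ∀ v → adj v v ≡ false
open Graph public

ProperColouring : (G : Graph) → (k : ℕ) → (Fin (n G) → Fin k) → Set
ProperColouring G k c = ∀ u v → adj G u v ≡ true → c u ≢ c v

Colourable : Graph → ℕ → Set
Colourable G k = Σ (Fin (n G) → Fin k) (ProperColouring G k)

IsChromaticNumber : Graph → ℕ → Set
IsChromaticNumber G k = Colourable G k × (∀ j → Colourable G j → k ≤ j)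

commonNbrs : (G : Graph) → Fin (n G) → Fin (n G) → ℕ
commonNbrs G u v =
  sum (map (λ w → if adj G u w ∧ adj G w v then 1 else 0) (allFinL (n G)))

Δ₂ : Graph → ℕ
Δ₂ G = foldr _⊔_ 0
  (concatMap (λ u → map (λ v → pair u v) (allFinL (n G))) (allFinL (n G)))
  where
  pair : Fin (n G) → Fin (n G) → ℕ
  pair u v with u ≟ v
  ... | yes _ = 0
  ... | no  _ = commonNbrs G u v

Star : Graph → Set
Star G = ∃[ k ] (IsChromaticNumber G k × Δ₂ G + 3 < k)

induced : (G : Graph) (m : ℕ) (f : Fin m → Fin (n G)) → Graph
induced G m f = record
  { n = m
  ; adj = λ i j → adj G (f i) (f j)
  ; sym = λ i j → sym G (f i) (f j)
  ; irrefl = λ i → irrefl G (f i)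
  }

VertexCritical : Graph → Set
VertexCritical G =
  Star G ×
  (∀ (m : ℕ) (f : Fin m → Fin (n G)) → Injective _≡_ _≡_ f → m < n G →
     ¬ Star (induced G m f))

Dominates : (G : Graph) → Fin (n G) → Fin (n G) → Set
Dominates G x y = ∀ w → adj G y w ≡ true → (w ≡ x ⊎ adj G x w ≡ true)

-- If x dominates y then N(y) ⊆ {x} ∪ (N(x) ∩ N(y)), a set of at most Δ₂(G) + 1 vertices,
-- so every j-colouring of G − y extends to G with max(j, Δ₂(G) + 2) colours. As
-- χ(G) > Δ₂(G) + 3, this forces χ(G − y) = χ(G); together with Δ₂(G − y) ≤ Δ₂(G) the
-- proper induced subgraph G − y would still have property (⋆), contradicting criticality.

module Submission where

open import Defs
open import Data.Product using (Σ; ∃-syntax; _×_)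
open import Relation.Nullary using (¬_)
open import Relation.Binary.PropositionalEquality using (_≢_)

open import Data.Bool using (Bool; true; false; _∧_; if_then_else_)
open import Data.Bool.Properties using (T-≡)
open import Data.Fin using (Fin; zero; suc; punchIn; punchOut; inject≤)
open import Data.Fin.Properties
  using (_≟_; 0≢1+n; suc-injective; punchIn-injective; punchIn-punchOut;
         punchOut-injective; inject≤-injective; injective⇒≤; ¬∀⟶∃¬)
open import Data.List
  using (List; []; _∷_; map; foldr; concatMap; length; filter; tabulate; allFin; lookup)
open import Data.List.Membership.Propositional using (_∈_; _∉_)
open import Data.List.Membership.Propositional.Properties using (∈-allFin; ∈-map⁺; ∈-filter⁺)
open import Data.List.Properties using (map-tabulate; length-map; foldr-preservesᵇ; foldr-forcesᵇ)
open import Data.List.Relation.Unary.All using (All)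
open import Data.List.Relation.Unary.All.Properties
  using (concat⁺; concat⁻; map⁺; map⁻; tabulate⁺; tabulate⁻)
open import Data.List.Relation.Unary.Any using (here; there; index; any?)
open import Data.List.Relation.Unary.Any.Properties using (lookup-index)
open import Data.Nat using (ℕ; zero; suc; _+_; _≤_; _<_; _⊔_; z≤n; s≤s)
open import Data.Nat.ListAction using (sum)
open import Data.Nat.Properties
  using (≤-refl; ≤-trans; ≤-<-trans; <⇒≤; <⇒≱; n<1+n; +-comm; +-monoʳ-≤; +-monoˡ-≤;
         m≤m⊔n; m≤n⊔m; ⊔-lub; ⊔-sel; m⊔n≤o⇒m≤o; m⊔n≤o⇒n≤o; +-0-commutativeMonoid;
         module ≤-Reasoning)
open import Algebra.Properties.CommutativeMonoid.Sum +-0-commutativeMonoid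
  using (sum-remove; sum-cong-≗) renaming (sum to ∑)
open import Data.Product using (_,_; proj₁; proj₂)
open import Data.Sum using (inj₁; inj₂)
open import Function using (_∘_; id; Injective; Equivalence)
open import Relation.Nullary using (Dec; yes; no; contradiction)
open import Relation.Nullary.Decidable using (T?)
open import Relation.Binary.PropositionalEquality
  using (_≡_; refl; trans; cong; cong₂; subst; module ≡-Reasoning) renaming (sym to ≡-sym)

sum-tabulate : ∀ {n} (g : Fin n → ℕ) → sum (tabulate g) ≡ ∑ g
sum-tabulate {zero}  g = refl
sum-tabulate {suc n} g = cong (g zero +_) (sum-tabulate (g ∘ suc))

sum-map-allFin : ∀ {n} (g : Fin n → ℕ) → sum (map g (allFin n)) ≡ ∑ g
sum-map-allFin g = trans (cong sum (map-tabulate id g)) (sum-tabulate g)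

∑-∘-injective-≤ : ∀ {m n} (g : Fin n → ℕ) {ι : Fin m → Fin n} →
                  Injective _≡_ _≡_ ι → ∑ (g ∘ ι) ≤ ∑ g
∑-∘-injective-≤ {zero}          g     _     = z≤n
∑-∘-injective-≤ {suc m} {zero}  g {ι} _     with ι zero
... | ()
∑-∘-injective-≤ {suc m} {suc n} g {ι} ι-inj = begin
  g a + ∑ (g ∘ ι ∘ suc)         ≡⟨ cong (g a +_) (sum-cong-≗ (cong g ∘ ≡-sym ∘ punchIn-punchOut ∘ a≢)) ⟩
  g a + ∑ (g ∘ punchIn a ∘ ι′)  ≤⟨ +-monoʳ-≤ (g a) (∑-∘-injective-≤ (g ∘ punchIn a) ι′-inj) ⟩
  g a + ∑ (g ∘ punchIn a)       ≡⟨ sum-remove g ⟨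
  ∑ g                           ∎
  where
  open ≤-Reasoning
  a : Fin (suc n)
  a = ι zero
  a≢ : ∀ i → a ≢ ι (suc i)
  a≢ i = 0≢1+n ∘ ι-inj
  ι′ : Fin m → Fin n
  ι′ i = punchOut (a≢ i)
  ι′-inj : Injective _≡_ _≡_ ι′
  ι′-inj = suc-injective ∘ ι-inj ∘ punchOut-injective (a≢ _) (a≢ _)

sum-allFin-∘-injective-≤ : ∀ {m n} (g : Fin n → ℕ) {ι : Fin m → Fin n} → Injective _≡_ _≡_ ι →
                           sum (map (g ∘ ι) (allFin m)) ≤ sum (map g (allFin n))
sum-allFin-∘-injective-≤ g {ι} ι-inj = begin
  sum (map (g ∘ ι) (allFin _))  ≡⟨ sum-map-allFin (g ∘ ι) ⟩
  ∑ (g ∘ ι)                     ≤⟨ ∑-∘-injective-≤ g ι-inj ⟩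
  ∑ g                           ≡⟨ sum-map-allFin g ⟨
  sum (map g (allFin _))        ∎
  where open ≤-Reasoning

length-filter-T? : ∀ {A : Set} (b : A → Bool) xs →
                   length (filter (T? ∘ b) xs) ≡ sum (map (λ x → if b x then 1 else 0) xs)
length-filter-T? b []       = refl
length-filter-T? b (x ∷ xs) with b x
... | true  = cong suc (length-filter-T? b xs)
... | false = length-filter-T? b xs

length<⇒∃∉ : ∀ {K} (xs : List (Fin K)) → length xs < K → ∃[ a ] a ∉ xs
length<⇒∃∉ {K} xs len<K =
  ¬∀⟶∃¬ K (_∈ xs) (λ a → any? (a ≟_) xs) (λ all∈ → <⇒≱ len<K (injective⇒≤ (index-injective all∈)))
  where
  index-injective : (all∈ : ∀ a → a ∈ xs) → Injective _≡_ _≡_ (index ∘ all∈)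
  index-injective all∈ {a} {b} eq = begin
    a                         ≡⟨ lookup-index (all∈ a) ⟩
    lookup xs (index (all∈ a)) ≡⟨ cong (lookup xs) eq ⟩
    lookup xs (index (all∈ b)) ≡⟨ lookup-index (all∈ b) ⟨
    b                         ∎
    where open ≡-Reasoning

maxOverPairs : ∀ {N} → (Fin N → Fin N → ℕ) → ℕ
maxOverPairs {N} F = foldr _⊔_ 0 (concatMap (λ u → map (F u) (allFin N)) (allFin N))

≤-maxOverPairs : ∀ {N} (F : Fin N → Fin N → ℕ) u v → F u v ≤ maxOverPairs F
≤-maxOverPairs F u v = tabulate⁻ (map⁻ (tabulate⁻ (map⁻ (concat⁻ all≤max)) u)) v
  where
  all≤max : All (_≤ maxOverPairs F) _
  all≤max = foldr-forcesᵇ (λ x y x⊔y≤ → m⊔n≤o⇒m≤o x y x⊔y≤ , m⊔n≤o⇒n≤o x y x⊔y≤) 0 _ ≤-refl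

maxOverPairs-lub : ∀ {N} (F : Fin N → Fin N → ℕ) {B} → (∀ u v → F u v ≤ B) → maxOverPairs F ≤ B
maxOverPairs-lub F {B} F≤B =
  foldr-preservesᵇ {P = _≤ B} ⊔-lub z≤n (concat⁺ (map⁺ (tabulate⁺ λ u → map⁺ (tabulate⁺ (F≤B u)))))

-- The pair function inside Δ₂ is a local with-function that cannot be named; unification names it.
Δ₂-pairs : (G : Graph) → Σ (Fin (n G) → Fin (n G) → ℕ) λ F → Δ₂ G ≡ maxOverPairs F
Δ₂-pairs G = _ , refl

pairCount : (G : Graph) → Fin (n G) → Fin (n G) → ℕ
pairCount G = proj₁ (Δ₂-pairs G)

pairCount-≢ : (G : Graph) {u v : Fin (n G)} → u ≢ v → pairCount G u v ≡ commonNbrs G u v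
pairCount-≢ G {u} {v} u≢v with u ≟ v
... | yes u≡v = contradiction u≡v u≢v
... | no  _   = refl

pairCount-≤ : (G : Graph) {B : ℕ} → (∀ u v → u ≢ v → commonNbrs G u v ≤ B) →
              ∀ u v → pairCount G u v ≤ B
pairCount-≤ G h u v with u ≟ v
... | yes _   = z≤n
... | no  u≢v = h u v u≢v

commonNbrs≤Δ₂ : (G : Graph) {u v : Fin (n G)} → u ≢ v → commonNbrs G u v ≤ Δ₂ G
commonNbrs≤Δ₂ G {u} {v} u≢v = subst (_≤ Δ₂ G) (pairCount-≢ G u≢v) (≤-maxOverPairs (pairCount G) u v)

Δ₂-lub : (G : Graph) {B : ℕ} → (∀ u v → u ≢ v → commonNbrs G u v ≤ B) → Δ₂ G ≤ B
Δ₂-lub G h = maxOverPairs-lub (pairCount G) (pairCount-≤ G h)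

commonNbrs-induced-≤ : (G : Graph) {m : ℕ} {f : Fin m → Fin (n G)} → Injective _≡_ _≡_ f →
                       ∀ u v → commonNbrs (induced G m f) u v ≤ commonNbrs G (f u) (f v)
commonNbrs-induced-≤ G f-inj u v = sum-allFin-∘-injective-≤ _ f-inj

Δ₂-induced-≤ : (G : Graph) {m : ℕ} {f : Fin m → Fin (n G)} → Injective _≡_ _≡_ f →
               Δ₂ (induced G m f) ≤ Δ₂ G
Δ₂-induced-≤ G {m} {f} f-inj = Δ₂-lub (induced G m f) λ u v u≢v →
  ≤-trans (commonNbrs-induced-≤ G f-inj u v) (commonNbrs≤Δ₂ G (u≢v ∘ f-inj))

colourable-induced : (G : Graph) {k m : ℕ} (f : Fin m → Fin (n G)) →
                     Colourable G k → Colourable (induced G m f) k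
colourable-induced G f (c , proper) = c ∘ f , λ u v → proper (f u) (f v)

colourable-mono : (G : Graph) {j K : ℕ} → j ≤ K → Colourable G j → Colourable G K
colourable-mono G j≤K (c , proper) =
  (λ w → inject≤ (c w) j≤K) , λ u v uv → proper u v uv ∘ inject≤-injective _ _ _ _

CoversAllBut : ∀ {m N} → (Fin m → Fin N) → Fin N → Set
CoversAllBut ι y = ∀ w → w ≢ y → ∃[ i ] ι i ≡ w

colourable-extend : (G : Graph) {m K : ℕ} {ι : Fin m → Fin (n G)} {y : Fin (n G)} → CoversAllBut ι y →
                    (c : Fin m → Fin K) → ProperColouring (induced G m ι) K c →
                    (a : Fin K) → (∀ i → adj G y (ι i) ≡ true → c i ≢ a) →
                    Colourable G K
colourable-extend G {K = K} {ι = ι} {y = y} covers c proper a a-free =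
  (λ w → colourAt w (w ≟ y)) , λ u v uv → colourAt-proper u v uv (u ≟ y) (v ≟ y)
  where
  colourAt : ∀ w → Dec (w ≡ y) → Fin K
  colourAt w (yes _)   = a
  colourAt w (no  w≢y) = c (proj₁ (covers w w≢y))

  colourAt-proper : ∀ u v → adj G u v ≡ true → ∀ du dv → colourAt u du ≢ colourAt v dv
  colourAt-proper u v uv (yes refl) (yes refl) _ = contradiction (trans (≡-sym uv) (irrefl G y)) λ ()
  colourAt-proper u v uv (yes refl) (no v≢y) with covers v v≢y
  ... | i , refl = a-free i uv ∘ ≡-sym
  colourAt-proper u v uv (no u≢y) (yes refl) with covers u u≢y
  ... | i , refl = a-free i (trans (sym G y (ι i)) uv)
  colourAt-proper u v uv (no u≢y) (no v≢y) with covers u u≢y | covers v v≢y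
  ... | i , refl | i′ , refl = proper i i′ uv

dominated-neighbours : (G : Graph) {m : ℕ} {ι : Fin m → Fin (n G)} {x y : Fin (n G)} →
                       Injective _≡_ _≡_ ι → CoversAllBut ι y → x ≢ y → Dominates G x y →
                       Σ (List (Fin m)) λ L → length L ≤ suc (Δ₂ G) × (∀ i → adj G y (ι i) ≡ true → i ∈ L)
dominated-neighbours G {m} {ι} {x} {y} ι-inj covers x≢y x▷y = x′ ∷ common , s≤s length-common≤Δ₂ , nbr∈
  where
  x′ : Fin m
  x′ = proj₁ (covers x x≢y)

  isCommon : Fin m → Bool
  isCommon i = adj G x (ι i) ∧ adj G (ι i) y

  common : List (Fin m)
  common = filter (T? ∘ isCommon) (allFin m)

  length-common≤Δ₂ : length common ≤ Δ₂ G
  length-common≤Δ₂ = begin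
    length common                                            ≡⟨ length-filter-T? isCommon (allFin m) ⟩
    sum (map (λ i → if isCommon i then 1 else 0) (allFin m)) ≤⟨ sum-allFin-∘-injective-≤ _ ι-inj ⟩
    commonNbrs G x y                                         ≤⟨ commonNbrs≤Δ₂ G x≢y ⟩
    Δ₂ G                                                     ∎
    where open ≤-Reasoning

  nbr∈ : ∀ i → adj G y (ι i) ≡ true → i ∈ x′ ∷ common
  nbr∈ i yi with x▷y (ι i) yi
  ... | inj₁ ιi≡x = here (ι-inj (trans ιi≡x (≡-sym (proj₂ (covers x x≢y)))))
  ... | inj₂ xi   = there (∈-filter⁺ (T? ∘ isCommon) (∈-allFin i)
                      (Equivalence.from T-≡ (cong₂ _∧_ xi (trans (sym G (ι i) y) yi))))

unused-colour : ∀ {m K} (c : Fin m → Fin K) (L : List (Fin m)) → length L < K →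
                ∃[ a ] (∀ i → i ∈ L → c i ≢ a)
unused-colour c L length<K with length<⇒∃∉ (map c L) (subst (_< _) (≡-sym (length-map c L)) length<K)
... | a , a∉ = a , λ i i∈L ci≡a → a∉ (subst (_∈ map c L) ci≡a (∈-map⁺ c i∈L))

colourable-dominated : (G : Graph) {m j : ℕ} {ι : Fin m → Fin (n G)} {x y : Fin (n G)} →
                       Injective _≡_ _≡_ ι → CoversAllBut ι y → x ≢ y → Dominates G x y →
                       Colourable (induced G m ι) j → Colourable G (j ⊔ suc (suc (Δ₂ G)))
colourable-dominated G {m} {j} {ι} ι-inj covers x≢y x▷y colH
  with colourable-mono (induced G m ι) (m≤m⊔n j _) colH | dominated-neighbours G ι-inj covers x≢y x▷y
... | c , proper | L , length-L≤ , nbr∈L with unused-colour c L (≤-<-trans length-L≤ (m≤n⊔m j _))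
... | a , a-unused = colourable-extend G covers c proper a λ i yi → a-unused i (nbr∈L i yi)

m≤n⊔o⇒o<m⇒m≤n : ∀ {m n o} → m ≤ n ⊔ o → o < m → m ≤ n
m≤n⊔o⇒o<m⇒m≤n {m} {n} {o} m≤n⊔o o<m with ⊔-sel n o
... | inj₁ n⊔o≡n = subst (m ≤_) n⊔o≡n m≤n⊔o
... | inj₂ n⊔o≡o = contradiction (subst (m ≤_) n⊔o≡o m≤n⊔o) (<⇒≱ o<m)

record VertexDeletion {N : ℕ} (y : Fin N) : Set where
  field
    m         : ℕ
    ι         : Fin m → Fin N
    injective : Injective _≡_ _≡_ ι
    m<N       : m < N
    covers    : CoversAllBut ι y

vertexDeletion : ∀ {N} (y : Fin N) → VertexDeletion y
vertexDeletion {suc m} y = record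
  { m         = m
  ; ι         = punchIn y
  ; injective = punchIn-injective y _ _
  ; m<N       = n<1+n m
  ; covers    = λ w w≢y → punchOut (w≢y ∘ ≡-sym) , punchIn-punchOut (w≢y ∘ ≡-sym)
  }

lemma3p2 : (G : Graph) → VertexCritical G →
    ¬ (∃[ x ] ∃[ y ] (x ≢ y × Dominates G x y))
lemma3p2 G ((k , (colG , minG) , Δ₂+3<k) , critical) (x , y , x≢y , x▷y) =
  critical m ι injective m<N (k , (colourable-induced G ι colG , minH) , Δ₂H+3<k)
  where
  open VertexDeletion (vertexDeletion y)

  Δ₂H+3<k : Δ₂ (induced G m ι) + 3 < k
  Δ₂H+3<k = ≤-<-trans (+-monoˡ-≤ 3 (Δ₂-induced-≤ G injective)) Δ₂+3<k

  Δ₂+2<k : suc (suc (Δ₂ G)) < k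
  Δ₂+2<k = <⇒≤ (subst (_< k) (+-comm (Δ₂ G) 3) Δ₂+3<k)

  minH : ∀ j → Colourable (induced G m ι) j → k ≤ j
  minH j colH = m≤n⊔o⇒o<m⇒m≤n (minG _ (colourable-dominated G injective covers x≢y x▷y colH)) Δ₂+2<k
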